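{- Let $(U,\mathcal{F})$ be an acyclic convex geometry and let $C$ be an essential set of $(U,\mathcal{F})$. Then every inclusion-wise maximal quasi-closed set of $C$ is of the form $C\setminus\{x\}$ for some $x\in C$.
   Context: All sets are finite. A closure system is a pair $(U,\mathcal{F})$ with $\mathcal{F}\subseteq 2^U$, $U\in\mathcal{F}$, closed under intersection; closure operator $\phi(A)=\bigcap\{C\in\mathcal{F}:A\subseteq C\}$. An implication $A\to B$ ($A,B\subseteq U$) is satisfied by $X$ if $A\subseteq X\Rightarrow B\subseteq X$; $(U,\Sigma)$ is an implicational base of $(U,\mathcal{F})$ if $\mathcal{F}$ is exactly the family of subsets satisfying all implications of $\Sigma$. The implication-graph of $(U,\Sigma)$ is the directed graph on $U$ with an arc $(a,b)$ whenever some $A\to B\in\Sigma$ has $a\in A$, $b\in B$ (assuming $A\cap B=\emptyset$). A closure system is acyclic if it admits an implicational base whose implication-graph has no directed cycle; acyclic closure systems are convex geometries. A set $Q$ is quasi-closed if $Q$ is not closed and for every $A\subseteq Q$, $\phi(A)\subsetneq\phi(Q)$ implies $\phi(A)\subseteq Q$. A closed set $C$ is essential if $C=\phi(Q)$ for some quasi-closed $Q$; the quasi-closed sets of $C$ are the quasi-closed $Q$ with $\phi(Q)=C$. -}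

module Defs where

open import Data.Nat using (ℕ)
open import Data.Fin using (Fin)
open import Data.Fin.Subset using (Subset; _∈_; _∉_; _⊆_; _⊂_; ⊤; _∩_)
open import Data.Product using (Σ; ∃; ∃-syntax; _×_; _,_; proj₁; proj₂)
open import Data.List using (List)
open import Data.List.Membership.Propositional using () renaming (_∈_ to _∈ₗ_)
open import Data.List.Relation.Unary.All using (All)
open import Relation.Binary.Construct.Closure.Transitive using (TransClosure)
open import Relation.Nullary using (¬_)
open import Function.Bundles using (_⇔_)

-- Ground set U = Fin n; a family of subsets of U is a predicate on Subset n
-- (F X means "X ∈ 𝓕").
Family : ℕ → Set₁
Family n = Subset n → Set

-- (U, 𝓕) is a closure system: U ∈ 𝓕 and 𝓕 is closed under (binary, hence
-- all finite nonempty) intersections.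
record IsClosureSystem {n : ℕ} (F : Family n) : Set where
  field
    top-closed : F ⊤
    ∩-closed   : ∀ X Y → F X → F Y → F (X ∩ Y)

-- φ(A) = C : C is the intersection of all members of 𝓕 containing A,
-- i.e. C ∈ 𝓕, A ⊆ C, and C ⊆ every member of 𝓕 containing A.
IsClosureOf : {n : ℕ} → Family n → Subset n → Subset n → Set
IsClosureOf F A C = F C × A ⊆ C × (∀ D → F D → A ⊆ D → C ⊆ D)

Implication : ℕ → Set
Implication n = Subset n × Subset n

SatisfiesImp : {n : ℕ} → Subset n → Implication n → Set
SatisfiesImp X (A , B) = A ⊆ X → B ⊆ X

IsImplicationalBase : {n : ℕ} → Family n → List (Implication n) → Set
IsImplicationalBase F Σs = ∀ X → F X ⇔ All (SatisfiesImp X) Σs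

-- Premise and conclusion disjoint (standing assumption A ∩ B = ∅).
DisjointImp : {n : ℕ} → Implication n → Set
DisjointImp (A , B) = ∀ x → x ∈ A → x ∉ B

Arc : {n : ℕ} → List (Implication n) → Fin n → Fin n → Set
Arc Σs a b = ∃[ imp ] (imp ∈ₗ Σs × a ∈ proj₁ imp × b ∈ proj₂ imp)

AcyclicGraph : {n : ℕ} → List (Implication n) → Set
AcyclicGraph {n} Σs = ∀ (a : Fin n) → ¬ TransClosure (Arc Σs) a a

IsAcyclic : {n : ℕ} → Family n → Set
IsAcyclic F = ∃[ Σs ] (IsImplicationalBase F Σs × All DisjointImp Σs × AcyclicGraph Σs)

IsQuasiClosed : {n : ℕ} → Family n → Subset n → Set
IsQuasiClosed F Q =
  ¬ F Q ×
  (∀ A φA φQ → A ⊆ Q → IsClosureOf F A φA → IsClosureOf F Q φQ → φA ⊂ φQ → φA ⊆ Q)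

IsQuasiClosedOf : {n : ℕ} → Family n → Subset n → Subset n → Set
IsQuasiClosedOf F C Q = IsQuasiClosed F Q × IsClosureOf F Q C

IsEssential : {n : ℕ} → Family n → Subset n → Set
IsEssential F C = F C × ∃[ Q ] IsQuasiClosedOf F C Q

IsMaximalQuasiClosedOf : {n : ℕ} → Family n → Subset n → Subset n → Set
IsMaximalQuasiClosedOf F C Q =
  IsQuasiClosedOf F C Q × (∀ Q′ → IsQuasiClosedOf F C Q′ → Q ⊆ Q′ → Q′ ⊆ Q)

-- Take x ∈ C ∖ Q with no arc of the implication graph from x back into C ∖ Q;
-- acyclicity provides such a sink. Adding x to Q keeps Q quasi-closed: for
-- A ⊆ Q ∪ {x} with φ(A) ⊊ C, the set φ(A) ∩ (Q ∪ {x}) is closed, because an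
-- implication with x in its premise can only conclude elements outside C ∖ Q,
-- and one without x in its premise has its premise in φ(A) ∩ Q, whose closure
-- lies in Q by quasi-closedness of Q. Hence Q ∪ {x} is quasi-closed unless it
-- is all of C, so a maximal Q must equal C ∖ {x}.
module Submission where

open import Defs
open import Data.Nat using (ℕ)
open import Data.Fin.Subset using (Subset; _∈_; _-_)
open import Data.Product using (∃-syntax; _×_)
open import Relation.Binary.PropositionalEquality using (_≡_)

open import Data.Bool using (Bool; true)
open import Data.Bool.Properties using (T-≡)
open import Data.Empty using (⊥-elim)
open import Data.Fin using (Fin; toℕ)
open import Data.Fin.Properties using (pigeonhole; any?)
open import Data.Fin.Subset using (_∉_; _⊆_; _⊂_; _∩_; _∪_; _─_; ⁅_⁆; inside; outside)
open import Data.Fin.Subset.Properties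
  using (_∈?_; _⊆?_; ⊆-antisym; anySubset?; p∩q⊆p; p∩q⊆q; x∈p∩q⁺; p⊆p∪q;
         x∈p∪q⁺; x∈p∪q⁻; x∈⁅x⁆; x∈⁅y⁆⇒x≡y; p─q⊆p; x∈p∧x≢y⇒x∈p-y)
open import Data.List using (List)
open import Data.List.Membership.Propositional using (find; lose) renaming (_∈_ to _∈ₗ_)
import Data.List.Relation.Unary.All as All
import Data.List.Relation.Unary.Any as Any
open import Data.Nat.Base using (_<′_; ≤′-refl; ≤′-step)
open import Data.Nat.Properties using (n<1+n; <⇒<′)
open import Data.Product using (∃; _,_; proj₁; proj₂; uncurry)
open import Data.Sum using ([_,_]′; inj₁; inj₂)
open import Data.Vec.Base using (_∷_; here; there; tabulate)
open import Data.Vec.Properties using (lookup∘tabulate; []=⇒lookup; lookup⇒[]=)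
open import Function using (_∘_)
open import Function.Bundles using (Equivalence)
open import Relation.Binary.Construct.Closure.Transitive using (TransClosure; [_]; _∷ʳ_)
open import Relation.Binary.PropositionalEquality using (refl; sym; trans; subst)
open import Relation.Nullary using (¬_; Dec; yes; no)
open import Relation.Nullary.Decidable
  using (map′; isYes; toWitness; fromWitness; decidable-stable; _×-dec_; _→-dec_; ¬?)
open Equivalence using (to; from)

x∈p─q⇒x∉q : ∀ {n} {x : Fin n} (p q : Subset n) → x ∈ p ─ q → x ∉ q
x∈p─q⇒x∉q (inside ∷ p) (outside ∷ q) here ()
x∈p─q⇒x∉q (_ ∷ p) (_ ∷ q) (there x∈p─q) (there x∈q) = x∈p─q⇒x∉q p q x∈p─q x∈q

x∈tabulate⇒T : ∀ {n} {f : Fin n → Bool} {x} → x ∈ tabulate f → f x ≡ true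
x∈tabulate⇒T {f = f} {x} x∈ = trans (sym (lookup∘tabulate f x)) ([]=⇒lookup x∈)

T⇒x∈tabulate : ∀ {n} {f : Fin n → Bool} {x} → f x ≡ true → x ∈ tabulate f
T⇒x∈tabulate {f = f} {x} fx = lookup⇒[]= x (tabulate f) (trans (lookup∘tabulate f x) fx)

module ImplicationalBase {n : ℕ} {F : Family n} {Σs : List (Implication n)}
                         (base : IsImplicationalBase F Σs) where

  closed⇒respects : ∀ {X A B} → F X → (A , B) ∈ₗ Σs → A ⊆ X → B ⊆ X
  closed⇒respects {X} FX = All.lookup (to (base X) FX)

  respects⇒closed : ∀ {X} → (∀ {A B} → (A , B) ∈ₗ Σs → A ⊆ X → B ⊆ X) → F X
  respects⇒closed {X} respects = from (base X) (All.tabulate respects)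

  closed? : ∀ X → Dec (F X)
  closed? X = map′ (from (base X)) (to (base X)) (All.all? satisfies? Σs)
    where
    satisfies? : ∀ imp → Dec (SatisfiesImp X imp)
    satisfies? (A , B) = (A ⊆? X) →-dec (B ⊆? X)

  Forced : Subset n → Fin n → Set
  Forced A x = ∀ D → F D → A ⊆ D → x ∈ D

  forced? : ∀ A x → Dec (Forced A x)
  forced? A x = map′ fromCounterexample toCounterexample
    (¬? (anySubset? (λ D → closed? D ×-dec ((A ⊆? D) ×-dec ¬? (x ∈? D)))))
    where
    fromCounterexample : ¬ ∃ (λ D → F D × A ⊆ D × x ∉ D) → Forced A x
    fromCounterexample none D FD A⊆D =
      decidable-stable (x ∈? D) (λ x∉D → none (D , FD , A⊆D , x∉D))
    toCounterexample : Forced A x → ¬ ∃ (λ D → F D × A ⊆ D × x ∉ D)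
    toCounterexample forced (D , FD , A⊆D , x∉D) = x∉D (forced D FD A⊆D)

  closure : Subset n → Subset n
  closure A = tabulate (isYes ∘ forced? A)

  ∈closure⇒forced : ∀ {A x} → x ∈ closure A → Forced A x
  ∈closure⇒forced x∈ = toWitness (from T-≡ (x∈tabulate⇒T x∈))

  forced⇒∈closure : ∀ {A x} → Forced A x → x ∈ closure A
  forced⇒∈closure forced = T⇒x∈tabulate (to T-≡ (fromWitness forced))

  closure-closed : ∀ A → F (closure A)
  closure-closed A = respects⇒closed λ imp∈Σs premise⊆ b∈ → forced⇒∈closure λ D FD A⊆D →
    closed⇒respects FD imp∈Σs (λ a∈ → ∈closure⇒forced (premise⊆ a∈) D FD A⊆D) b∈

  ⊆-closure : ∀ A → A ⊆ closure A
  ⊆-closure A a∈A = forced⇒∈closure λ _ _ A⊆D → A⊆D a∈A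

  closure-least : ∀ A D → F D → A ⊆ D → closure A ⊆ D
  closure-least A D FD A⊆D x∈ = ∈closure⇒forced x∈ D FD A⊆D

  closure-isClosureOf : ∀ A → IsClosureOf F A (closure A)
  closure-isClosureOf A = closure-closed A , ⊆-closure A , closure-least A

module _ {n : ℕ} {R : Fin n → Fin n → Set} {S : Fin n → Set}
         (step : ∀ {a} → S a → ∃ λ b → S b × R a b) where

  private
    successor : ∃ S → ∃ S
    successor (a , Sa) = proj₁ (step Sa) , proj₁ (proj₂ (step Sa))

    successor-related : ∀ p → R (proj₁ p) (proj₁ (successor p))
    successor-related (a , Sa) = proj₂ (proj₂ (step Sa))

    walk : ∃ S → ℕ → ∃ S
    walk p ℕ.zero    = p
    walk p (ℕ.suc k) = successor (walk p k)

    walk-path : ∀ p {i j} → i <′ j → TransClosure R (proj₁ (walk p i)) (proj₁ (walk p j))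
    walk-path p {i} ≤′-refl = [ successor-related (walk p i) ]
    walk-path p {j = ℕ.suc j} (≤′-step i<j) = walk-path p i<j ∷ʳ successor-related (walk p j)

  no-sink⇒cycle : ∃ S → ∃ λ a → TransClosure R a a
  no-sink⇒cycle p with pigeonhole (n<1+n n) (λ i → proj₁ (walk p (toℕ i)))
  ... | i , j , i<j , same =
    proj₁ (walk p (toℕ i)) , subst (TransClosure R _) (sym same) (walk-path p (<⇒<′ i<j))

acyclic⇒sink : ∀ {n} {R : Fin n → Fin n → Set} {S : Fin n → Set} →
               (∀ a b → Dec (R a b)) → (∀ a → Dec (S a)) →
               (∀ a → ¬ TransClosure R a a) → ∃ S →
               ∃ λ s → S s × (∀ t → S t → ¬ R s t)
acyclic⇒sink {R = R} {S} R? S? acyclic p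
  with any? (λ s → S? s ×-dec ¬? (any? (λ t → S? t ×-dec R? s t)))
... | yes (s , Ss , noSuccessor) = s , Ss , λ t St Rst → noSuccessor (t , St , Rst)
... | no noSink = ⊥-elim (uncurry acyclic (no-sink⇒cycle step p))
  where
  step : ∀ {s} → S s → ∃ λ t → S t × R s t
  step {s} Ss = decidable-stable (any? (λ t → S? t ×-dec R? s t))
                                 (λ noSuccessor → noSink (s , Ss , noSuccessor))

arc? : ∀ {n} (Σs : List (Implication n)) a b → Dec (Arc Σs a b)
arc? Σs a b = map′ find (λ (imp , imp∈Σs , a∈b∈) → lose imp∈Σs a∈b∈)
                (Any.any? (λ imp → (a ∈? proj₁ imp) ×-dec (b ∈? proj₂ imp)) Σs)

¬closed⇒∃∈closure∖ : ∀ {n} {F : Family n} {Q C} → IsClosureOf F Q C → ¬ F Q →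
                ∃ λ y → y ∈ C × y ∉ Q
¬closed⇒∃∈closure∖ {F = F} {Q} {C} (FC , Q⊆C , _) ¬FQ =
  decidable-stable (any? (λ y → (y ∈? C) ×-dec ¬? (y ∈? Q))) λ none →
    ¬FQ (subst F (⊆-antisym (C⊆Q none) Q⊆C) FC)
  where
  C⊆Q : ¬ ∃ (λ y → y ∈ C × y ∉ Q) → C ⊆ Q
  C⊆Q none {y} y∈C = decidable-stable (y ∈? Q) (λ y∉Q → none (y , y∈C , y∉Q))

isClosureOf-between : ∀ {n} {F : Family n} {Q Q′ C} → IsClosureOf F Q C →
                      Q ⊆ Q′ → Q′ ⊆ C → IsClosureOf F Q′ C
isClosureOf-between (FC , _ , minimal) Q⊆Q′ Q′⊆C =
  FC , Q′⊆C , λ D FD Q′⊆D → minimal D FD (Q′⊆D ∘ Q⊆Q′)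

module _ {n : ℕ} {F : Family n} {Σs : List (Implication n)}
         (base : IsImplicationalBase F Σs) where

  open ImplicationalBase base

  ∩-insert-sink-closed : ∀ {C Q D x} → F D → D ⊆ C → closure (D ∩ Q) ⊆ Q →
                         (∀ b → b ∈ C × b ∉ Q → ¬ Arc Σs x b) →
                         F (D ∩ (Q ∪ ⁅ x ⁆))
  ∩-insert-sink-closed {C} {Q} {D} {x} FD D⊆C closure⊆Q sink = respects⇒closed respects
    where
    respects : ∀ {A B} → (A , B) ∈ₗ Σs → A ⊆ D ∩ (Q ∪ ⁅ x ⁆) → B ⊆ D ∩ (Q ∪ ⁅ x ⁆)
    respects {A} {B} imp∈Σs A⊆ {b} b∈B = x∈p∩q⁺ (b∈D , b∈Q∪x (x ∈? A))
      where
      b∈D : b ∈ D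
      b∈D = closed⇒respects FD imp∈Σs (p∩q⊆p D _ ∘ A⊆) b∈B

      A⊆closure : x ∉ A → A ⊆ closure (D ∩ Q)
      A⊆closure x∉A {a} a∈A with x∈p∪q⁻ Q ⁅ x ⁆ (p∩q⊆q D _ (A⊆ a∈A))
      ... | inj₁ a∈Q = ⊆-closure (D ∩ Q) (x∈p∩q⁺ (p∩q⊆p D _ (A⊆ a∈A) , a∈Q))
      ... | inj₂ a∈⁅x⁆ = ⊥-elim (x∉A (subst (_∈ A) (x∈⁅y⁆⇒x≡y x a∈⁅x⁆) a∈A))

      b∈Q∪x : Dec (x ∈ A) → b ∈ Q ∪ ⁅ x ⁆
      b∈Q∪x (yes x∈A) = p⊆p∪q ⁅ x ⁆ (decidable-stable (b ∈? Q) λ b∉Q →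
        sink b (D⊆C b∈D , b∉Q) ((A , B) , imp∈Σs , x∈A , b∈B))
      b∈Q∪x (no x∉A) = p⊆p∪q ⁅ x ⁆ (closure⊆Q
        (closed⇒respects (closure-closed (D ∩ Q)) imp∈Σs (A⊆closure x∉A) b∈B))

  insert-sink-isQuasiClosedOf : ∀ {C Q x y} → IsQuasiClosedOf F C Q → x ∈ C →
                                (∀ b → b ∈ C × b ∉ Q → ¬ Arc Σs x b) →
                                y ∈ C → y ∉ Q → y ∉ ⁅ x ⁆ →
                                IsQuasiClosedOf F C (Q ∪ ⁅ x ⁆)
  insert-sink-isQuasiClosedOf {C} {Q} {x} ((_ , quasiClosed) , Q↦C@(FC , Q⊆C , C-least))
                              x∈C sink y∈C y∉Q y∉⁅x⁆ =
    (¬closed , quasiClosed′) , isClosureOf-between Q↦C Q⊆Q′ Q′⊆C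
    where
    Q′ = Q ∪ ⁅ x ⁆

    Q⊆Q′ : Q ⊆ Q′
    Q⊆Q′ = p⊆p∪q ⁅ x ⁆

    Q′⊆C : Q′ ⊆ C
    Q′⊆C z∈Q′ with x∈p∪q⁻ Q ⁅ x ⁆ z∈Q′
    ... | inj₁ z∈Q = Q⊆C z∈Q
    ... | inj₂ z∈⁅x⁆ = subst (_∈ C) (sym (x∈⁅y⁆⇒x≡y x z∈⁅x⁆)) x∈C

    ¬closed : ¬ F Q′
    ¬closed FQ′ = [ y∉Q , y∉⁅x⁆ ]′ (x∈p∪q⁻ Q ⁅ x ⁆ (C-least Q′ FQ′ Q⊆Q′ y∈C))

    quasiClosed′ : ∀ A φA φQ′ → A ⊆ Q′ → IsClosureOf F A φA → IsClosureOf F Q′ φQ′ →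
                   φA ⊂ φQ′ → φA ⊆ Q′
    quasiClosed′ A φA φQ′ A⊆Q′ (FφA , A⊆φA , φA-least) (_ , _ , φQ′-least)
                 (φA⊆φQ′ , w , w∈φQ′ , w∉φA) =
      p∩q⊆q φA Q′ ∘ φA-least (φA ∩ Q′) FZ (λ a∈A → x∈p∩q⁺ (A⊆φA a∈A , A⊆Q′ a∈A))
      where
      φQ′⊆C : φQ′ ⊆ C
      φQ′⊆C = φQ′-least C FC Q′⊆C

      P = φA ∩ Q

      closureP⊆φA : closure P ⊆ φA
      closureP⊆φA = closure-least P φA FφA (p∩q⊆p φA Q)

      closureP⊆Q : closure P ⊆ Q
      closureP⊆Q = quasiClosed P (closure P) C (p∩q⊆q φA Q) (closure-isClosureOf P) Q↦C
        ( closure-least P C FC (Q⊆C ∘ p∩q⊆q φA Q)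
        , w , φQ′⊆C w∈φQ′ , w∉φA ∘ closureP⊆φA)

      FZ : F (φA ∩ Q′)
      FZ = ∩-insert-sink-closed FφA (φQ′⊆C ∘ φA⊆φQ′) closureP⊆Q sink

  maximal-quasiClosed≡-sink : ∀ {C Q x} → IsMaximalQuasiClosedOf F C Q → x ∈ C → x ∉ Q →
                              (∀ b → b ∈ C × b ∉ Q → ¬ Arc Σs x b) → Q ≡ C - x
  maximal-quasiClosed≡-sink {C} {Q} {x} (Q-qc@(_ , (_ , Q⊆C , _)) , maximal) x∈C x∉Q sink =
    ⊆-antisym Q⊆C-x C-x⊆Q
    where
    Q⊆C-x : Q ⊆ C - x
    Q⊆C-x q∈Q = x∈p∧x≢y⇒x∈p-y (Q⊆C q∈Q) (λ { refl → x∉Q q∈Q })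

    C-x⊆Q : C - x ⊆ Q
    C-x⊆Q {y} y∈C-x = decidable-stable (y ∈? Q) λ y∉Q →
      x∉Q (maximal (Q ∪ ⁅ x ⁆)
        (insert-sink-isQuasiClosedOf Q-qc x∈C sink (p─q⊆p C ⁅ x ⁆ y∈C-x) y∉Q
                                     (x∈p─q⇒x∉q C ⁅ x ⁆ y∈C-x))
        (p⊆p∪q ⁅ x ⁆) (x∈p∪q⁺ (inj₂ (x∈⁅x⁆ x))))

lemma5 : {n : ℕ} (F : Family n) → IsClosureSystem F → IsAcyclic F →
         (C : Subset n) → IsEssential F C →
         (Q : Subset n) → IsMaximalQuasiClosedOf F C Q →
         ∃[ x ] (x ∈ C × Q ≡ C - x)
lemma5 F _ (Σs , base , _ , acyclic) C _ Q maximal@(((¬FQ , _) , Q↦C) , _)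
  with acyclic⇒sink (arc? Σs) (λ y → (y ∈? C) ×-dec ¬? (y ∈? Q)) acyclic
                    (¬closed⇒∃∈closure∖ Q↦C ¬FQ)
... | x , (x∈C , x∉Q) , sink =
  x , x∈C , maximal-quasiClosed≡-sink base maximal x∈C x∉Q sink
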